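{- If $A \subset \mathbb Z_{>0}$ is a finite nonempty set with $|A| = n$, then $C(A) < 1/2$.
   Context: $C(A) = \dfrac{\#\{(a,a') \in A \times A \colon a + a' \in A\}}{|A|^2}$. -}

module Defs where

open import Data.Nat using (ℕ; zero; suc; _+_; _*_; _<_)
open import Data.Nat.Properties using (_≟_)
open import Data.Integer using (+_)
open import Data.List using (List; []; _∷_; length; filter; cartesianProduct)
open import Data.List.Membership.DecPropositional _≟_ using (_∈?_)
open import Data.Product using (_×_; _,_; proj₁; proj₂)
open import Data.Rational.Unnormalised using (ℚᵘ; _/_; 0ℚᵘ)

-- A finite set of naturals represented as a duplicate-free list.
-- Number of ordered pairs (a , a') ∈ A × A with a + a' ∈ A.
sumPairs : List ℕ → ℕ
sumPairs A = length (filter (λ p → (proj₁ p + proj₂ p) ∈? A) (cartesianProduct A A))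

-- C(A) = #{(a,a') ∈ A×A : a + a' ∈ A} / |A|² ; (convention C(∅) = 0, never used)
C : List ℕ → ℚᵘ
C [] = 0ℚᵘ
C A@(_ ∷ xs) = (+ sumPairs A) / (suc (length xs) * suc (length xs))

module Submission where

-- For a fixed a, the map b ↦ a + b is injective and, as every b ∈ A is
-- positive, sends {b ∈ A : a + b ∈ A} into {c ∈ A : a < c}.  Summing over
-- a ∈ A, the number of additive pairs is at most the number P(A) of ordered
-- pairs (a , c) ∈ A × A with a < c.  By trichotomy, the n² pairs of A × A
-- consist of the n diagonal pairs, the pairs with a < c and (by swapping the
-- coordinates) equally many with c < a; hence 2·P(A) + n = n².  Therefore
-- 2·#{(a,a') : a + a' ∈ A} ≤ 2·P(A) = n² − n < n², which is C(A) < 1/2.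

open import Defs
open import Data.Nat using (ℕ; _<_; zero; suc)
open import Data.List using (List; []; length)
open import Data.List.Relation.Unary.All using (All)
open import Data.List.Relation.Unary.Unique.Propositional using (Unique)
open import Data.Rational.Unnormalised using (½) renaming (_<_ to _<ℚ_)
open import Relation.Binary.PropositionalEquality using (_≢_)

open import Data.Nat using (_+_; _*_; _≤_; z≤n; s≤s; z<s; _<?_)
open import Data.Nat.Properties
open import Data.Nat.ListAction using (sum)
open import Data.Nat.Tactic.RingSolver using (solve-∀)
open import Data.List using (_∷_; _++_; filter; map; cartesianProduct)
open import Data.List.Properties using (length-map; length-++; filter-++; filter-accept; filter-reject; length-removeAt′)
open import Data.List.Relation.Unary.All as All using ([]; _∷_)
open import Data.List.Relation.Unary.Any using (here; there; _─_)
open import Data.List.Relation.Unary.AllPairs using (_∷_)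
import Data.List.Relation.Unary.Unique.Propositional.Properties as Unique
open import Data.List.Membership.Propositional using (_∈_)
open import Data.List.Membership.Propositional.Properties using (∈-filter⁺; ∈-filter⁻; ∈-map⁻)
open import Data.List.Membership.DecPropositional _≟_ using (_∈?_)
open import Data.List.Relation.Binary.Subset.Propositional using (_⊆_)
open import Data.Product using (_×_; _,_)
open import Data.Bool using (true; false)
open import Data.Empty using (⊥-elim)
open import Level using (Level)
open import Relation.Nullary using (¬_; does)
open import Relation.Binary using (tri<; tri≈; tri>)
open import Relation.Unary using (Pred; Decidable)
open import Algebra.Properties.CommutativeSemigroup +-commutativeSemigroup
  using () renaming (x∙yz≈y∙xz to +-left-comm)
open import Relation.Binary.PropositionalEquality
  using (_≡_; refl; sym; trans; cong; cong₂; subst; subst₂; module ≡-Reasoning)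
import Data.Integer as ℤ
import Data.Integer.Properties as ℤ
import Data.Rational.Unnormalised as ℚᵘ

private
  variable
    a b p : Level
    A : Set a
    B : Set b

count : {P : Pred A p} → Decidable P → List A → ℕ
count P? xs = length (filter P? xs)

count-accept : {P : Pred A p} (P? : Decidable P) {x : A} {xs : List A} →
  P x → count P? (x ∷ xs) ≡ suc (count P? xs)
count-accept P? Px = cong length (filter-accept P? Px)

count-reject : {P : Pred A p} (P? : Decidable P) {x : A} {xs : List A} →
  ¬ P x → count P? (x ∷ xs) ≡ count P? xs
count-reject P? ¬Px = cong length (filter-reject P? ¬Px)

∈-─ : ∀ {x y : A} {xs : List A} (x∈xs : x ∈ xs) → y ∈ xs → y ≢ x → y ∈ (xs ─ x∈xs)
∈-─ (here refl) (here refl)  y≢x = ⊥-elim (y≢x refl)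
∈-─ (here refl) (there y∈xs) y≢x = y∈xs
∈-─ (there x∈xs) (here refl)  y≢x = here refl
∈-─ (there x∈xs) (there y∈xs) y≢x = there (∈-─ x∈xs y∈xs y≢x)

unique-⊆⇒length≤ : {xs ys : List A} → Unique xs → xs ⊆ ys → length xs ≤ length ys
unique-⊆⇒length≤ {xs = []}     _             _  = z≤n
unique-⊆⇒length≤ {xs = x ∷ xs} {ys} (x≢xs ∷ u) xs⊆ys =
  subst (suc (length xs) ≤_) (sym (length-removeAt′ ys _))
    (s≤s (unique-⊆⇒length≤ u rest⊆))
  where
  x∈ys : x ∈ ys
  x∈ys = xs⊆ys (here refl)
  rest⊆ : xs ⊆ (ys ─ x∈ys)
  rest⊆ y∈xs = ∈-─ x∈ys (xs⊆ys (there y∈xs)) (λ y≡x → All.lookup x≢xs y∈xs (sym y≡x))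

count-map : {P : Pred B p} (P? : Decidable P) (f : A → B) (xs : List A) →
  count P? (map f xs) ≡ count (λ x → P? (f x)) xs
count-map P? f []       = refl
count-map P? f (x ∷ xs) with does (P? (f x))
... | true  = cong suc (count-map P? f xs)
... | false = count-map P? f xs

count-rows : {P : Pred (A × B) p} (P? : Decidable P) (xs : List A) (ys : List B) →
  count P? (cartesianProduct xs ys) ≡ sum (map (λ x → count (λ y → P? (x , y)) ys) xs)
count-rows P? []       ys = refl
count-rows P? (x ∷ xs) ys = begin
  length (filter P? (map (x ,_) ys ++ cartesianProduct xs ys))
    ≡⟨ cong length (filter-++ P? (map (x ,_) ys) _) ⟩
  length (filter P? (map (x ,_) ys) ++ filter P? (cartesianProduct xs ys))
    ≡⟨ length-++ (filter P? (map (x ,_) ys)) ⟩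
  count P? (map (x ,_) ys) + count P? (cartesianProduct xs ys)
    ≡⟨ cong₂ _+_ (count-map P? (x ,_) ys) (count-rows P? xs ys) ⟩
  count (λ y → P? (x , y)) ys + sum (map (λ x → count (λ y → P? (x , y)) ys) xs) ∎
  where open ≡-Reasoning

sum-map-mono : (f g : A → ℕ) → (∀ x → f x ≤ g x) → (xs : List A) →
  sum (map f xs) ≤ sum (map g xs)
sum-map-mono f g f≤g []       = z≤n
sum-map-mono f g f≤g (x ∷ xs) = +-mono-≤ (f≤g x) (sum-map-mono f g f≤g xs)

above below : ℕ → List ℕ → ℕ
above x ys = count (x <?_) ys
below x ys = count (_<? x) ys

ascending : List ℕ → List ℕ → ℕ
ascending xs ys = sum (map (λ x → above x ys) xs)

-- For a set A of positive integers and any a, the b ∈ A with a + b ∈ A are at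
-- most as many as the elements of A above a: b ↦ a + b injects the former
-- into the latter.
row-bound : (A : List ℕ) → Unique A → All (0 <_) A → (a : ℕ) →
  count (λ b → (a + b) ∈? A) A ≤ above a A
row-bound A u pos a =
  subst (_≤ above a A) (length-map (a +_) F)
    (unique-⊆⇒length≤ (Unique.map⁺ (+-cancelˡ-≡ a _ _) (Unique.filter⁺ _ u)) image⊆)
  where
  F : List ℕ
  F = filter (λ b → (a + b) ∈? A) A
  image⊆ : map (a +_) F ⊆ filter (a <?_) A
  image⊆ c∈image with ∈-map⁻ (a +_) c∈image
  ... | b , b∈F , refl with ∈-filter⁻ (λ b → (a + b) ∈? A) b∈F
  ... | b∈A , a+b∈A = ∈-filter⁺ (a <?_) a+b∈A (m<m+n a (All.lookup pos b∈A))

sumPairs≤ascending : (A : List ℕ) → Unique A → All (0 <_) A → sumPairs A ≤ ascending A A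
sumPairs≤ascending A u pos = subst (_≤ ascending A A) (sym (count-rows _ A A))
  (sum-map-mono _ (λ x → above x A) (row-bound A u pos) A)

above-self : (x : ℕ) (ys : List ℕ) → above x (x ∷ ys) ≡ above x ys
above-self x ys = count-reject (x <?_) (<-irrefl refl)

above+below : (x : ℕ) (ys : List ℕ) → All (x ≢_) ys → above x ys + below x ys ≡ length ys
above+below x []       []            = refl
above+below x (y ∷ ys) (x≢y ∷ x≢ys) with <-cmp x y
... | tri< x<y _ y≮x = trans (cong₂ _+_ (count-accept (x <?_) x<y) (count-reject (_<? x) y≮x))
                             (cong suc (above+below x ys x≢ys))
... | tri≈ _ x≡y _   = ⊥-elim (x≢y x≡y)
... | tri> x≮y _ y<x = trans (cong₂ _+_ (count-reject (x <?_) x≮y) (count-accept (_<? x) y<x))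
                             (trans (+-suc _ _) (cong suc (above+below x ys x≢ys)))

ascending-∷ʳ : (xs : List ℕ) (y : ℕ) (ys : List ℕ) →
  ascending xs (y ∷ ys) ≡ below y xs + ascending xs ys
ascending-∷ʳ []       y ys = refl
ascending-∷ʳ (x ∷ xs) y ys with does (x <? y)
... | true  = cong suc (trans (cong (above x ys +_) (ascending-∷ʳ xs y ys))
                              (+-left-comm (above x ys) (below y xs) _))
... | false = trans (cong (above x ys +_) (ascending-∷ʳ xs y ys))
                    (+-left-comm (above x ys) (below y xs) _)

-- In a duplicate-free list of length n the ordered pairs a < c and c < a are
-- equinumerous and, with the diagonal, exhaust all n² pairs.
ascending-identity : (A : List ℕ) → Unique A →
  2 * ascending A A + length A ≡ length A * length A
ascending-identity []       _          = refl
ascending-identity (x ∷ xs) (x≢xs ∷ u) = begin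
  2 * ascending (x ∷ xs) (x ∷ xs) + suc n
    ≡⟨ cong (λ k → 2 * k + suc n) ascending-x∷xs ⟩
  2 * (n + S) + suc n
    ≡⟨ rearrange n S ⟩
  (2 * S + n) + (2 * n + 1)
    ≡⟨ cong (_+ (2 * n + 1)) (ascending-identity xs u) ⟩
  n * n + (2 * n + 1)
    ≡⟨ square-suc n ⟩
  suc n * suc n ∎
  where
  open ≡-Reasoning
  n S : ℕ
  n = length xs
  S = ascending xs xs
  ascending-x∷xs : ascending (x ∷ xs) (x ∷ xs) ≡ n + S
  ascending-x∷xs = begin
    above x (x ∷ xs) + ascending xs (x ∷ xs)
      ≡⟨ cong₂ _+_ (above-self x xs) (ascending-∷ʳ xs x xs) ⟩
    above x xs + (below x xs + S)
      ≡⟨ sym (+-assoc (above x xs) _ S) ⟩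
    above x xs + below x xs + S
      ≡⟨ cong (_+ S) (above+below x xs x≢xs) ⟩
    n + S ∎
  rearrange : ∀ n S → 2 * (n + S) + suc n ≡ (2 * S + n) + (2 * n + 1)
  rearrange = solve-∀
  square-suc : ∀ n → n * n + (2 * n + 1) ≡ suc n * suc n
  square-suc = solve-∀

double-sumPairs< : (A : List ℕ) → Unique A → All (0 <_) A → A ≢ [] →
  2 * sumPairs A < length A * length A
double-sumPairs< [] _ _ A≢[] = ⊥-elim (A≢[] refl)
double-sumPairs< A@(_ ∷ _) u pos _ = begin-strict
  2 * sumPairs A         ≤⟨ *-monoʳ-≤ 2 (sumPairs≤ascending A u pos) ⟩
  2 * ascending A A      <⟨ m<m+n (2 * ascending A A) z<s ⟩
  2 * ascending A A + length A ≡⟨ ascending-identity A u ⟩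
  length A * length A    ∎
  where open ≤-Reasoning

/-<-½ : (k d : ℕ) → 2 * k < suc d → (ℤ.+ k) ℚᵘ./ suc d <ℚ ½
/-<-½ k d 2k<d = ℚᵘ.*<* (subst₂ ℤ._<_ (ℤ.pos-* k 2) (ℤ.pos-* 1 (suc d))
  (ℤ.+<+ (subst₂ _<_ (*-comm 2 k) (sym (*-identityˡ (suc d))) 2k<d)))

lemma6p1 : (A : List ℕ) → Unique A → All (λ a → 0 < a) A → A ≢ [] →
    C A <ℚ ½
lemma6p1 [] _ _ A≢[] = ⊥-elim (A≢[] refl)
lemma6p1 A@(_ ∷ _) u pos A≢[] =
  /-<-½ (sumPairs A) _ (double-sumPairs< A u pos A≢[])
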